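{- Let $0\le k<n$, let $0<t_1<\cdots<t_n$ be real numbers, and let $V\in\mathrm{Gr}_{k,n}^{>0}$ be the span of the vectors $(t_1^j,\dots,t_n^j)$ for $1\le j\le k$. Then $w=(1,\dots,1)$ is positively oriented with respect to $V$.
   Context: $\mathrm{Gr}_{k,n}^{>0}$ is the set of $k$-dimensional subspaces of $\mathbb{R}^n$ whose Plücker coordinates are all positive (for a suitable representative). Positive orientation: if $V\in\mathrm{Gr}_{k,n}^{>0}$ and $w\in\mathbb{R}^n\setminus V$ with $V+\mathbb{R}w\in\mathrm{Gr}_{k+1,n}^{>0}$, let $U:=V^\perp\cap(V+\mathbb{R}w)$, a line, and let $u\in U$ be the vector with $w-u\in V$. Then $u_1\ne0$, and $w$ is called positively oriented with respect to $V$ if $u_1>0$ (negatively oriented if $u_1<0$). -}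

module Defs where

open import Level using (Level; _⊔_) renaming (suc to lsuc)
open import Algebra.Bundles using (CommutativeRing)
open import Data.Nat as ℕ using (ℕ)
open import Data.Fin as Fin using (Fin; punchIn)
open import Data.Product using (Σ; _×_; _,_)
open import Data.Sum using (_⊎_)
open import Relation.Nullary using (¬_)

record OrderedField c ℓ : Set (lsuc (c ⊔ ℓ)) where
  field
    commutativeRing : CommutativeRing c ℓ
  open CommutativeRing commutativeRing public
  field
    Pos         : Carrier → Set ℓ
    Pos-resp    : ∀ {x y} → x ≈ y → Pos x → Pos y
    Pos-+       : ∀ {x y} → Pos x → Pos y → Pos (x + y)
    Pos-*       : ∀ {x y} → Pos x → Pos y → Pos (x * y)
    Pos-irrefl  : ¬ Pos 0#
    Pos-trichotomy : ∀ x → Pos x ⊎ (x ≈ 0# ⊎ Pos (- x))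
    Pos-asym    : ∀ {x} → Pos x → ¬ Pos (- x)
    nontrivial  : ¬ (1# ≈ 0#)
    inverse     : ∀ x → ¬ (x ≈ 0#) → Σ Carrier λ y → x * y ≈ 1#

  _<ᶠ_ : Carrier → Carrier → Set ℓ
  x <ᶠ y = Pos (y - x)

module LinAlg {c ℓ} (F : OrderedField c ℓ) where
  open OrderedField F public

  Vector : ℕ → Set c
  Vector n = Fin n → Carrier

  Matrix : ℕ → ℕ → Set c
  Matrix k n = Fin k → Fin n → Carrier

  Σᶠ : ∀ {m} → (Fin m → Carrier) → Carrier
  Σᶠ {ℕ.zero}  f = 0#
  Σᶠ {ℕ.suc m} f = f Fin.zero + Σᶠ (λ i → f (Fin.suc i))

  _^_ : Carrier → ℕ → Carrier
  x ^ ℕ.zero  = 1#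
  x ^ ℕ.suc m = x * (x ^ m)

  sign : ℕ → Carrier
  sign ℕ.zero    = 1#
  sign (ℕ.suc m) = - sign m

  _·_ : ∀ {n} → Vector n → Vector n → Carrier
  u · v = Σᶠ (λ i → u i * v i)

  det : ∀ {m} → Matrix m m → Carrier
  det {ℕ.zero}  M = 1#
  det {ℕ.suc m} M =
    Σᶠ (λ j → sign (Fin.toℕ j) * (M Fin.zero j * det (λ r s → M (Fin.suc r) (punchIn j s))))

  _∈span_ : ∀ {k n} → Vector n → Matrix k n → Set (c ⊔ ℓ)
  _∈span_ {k} x A = Σ (Vector k) λ a → ∀ i → x i ≈ Σᶠ (λ j → a j * A j i)

  SameSpan : ∀ {k m n} → Matrix k n → Matrix m n → Set (c ⊔ ℓ)
  SameSpan A B = (∀ i → A i ∈span B) × (∀ i → B i ∈span A)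

  Increasing : ∀ {k n} → (Fin k → Fin n) → Set
  Increasing I = ∀ i j → i Fin.< j → I i Fin.< I j

  plücker : ∀ {k n} → Matrix k n → (Fin k → Fin n) → Carrier
  plücker B I = det (λ r s → B r (I s))

  -- The row span of A is a point of Gr_{k,n}^{>0}: it has a k × n
  -- representative with the same row span all of whose Plücker
  -- coordinates are positive (this forces dimension exactly k).
  TotallyPositive : ∀ {k n} → Matrix k n → Set (c ⊔ ℓ)
  TotallyPositive {k} {n} A =
    Σ (Matrix k n) λ B → SameSpan A B ×
      (∀ (I : Fin k → Fin n) → Increasing I → Pos (plücker B I))

  -- rows of A together with w: a spanning family of V + ℝw
  extend : ∀ {k n} → Matrix k n → Vector n → Matrix (ℕ.suc k) n
  extend A w Fin.zero    = w
  extend A w (Fin.suc i) = A i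

  _∈perp_ : ∀ {k n} → Vector n → Matrix k n → Set (c ⊔ ℓ)
  u ∈perp A = ∀ x → x ∈span A → (x · u) ≈ 0#

  -- w is positively oriented with respect to V = row span of A
  -- (n = suc m so that the first coordinate u_1 = u Fin.zero exists).
  -- All preconditions of the definition are included: V ∈ Gr^{>0},
  -- w ∉ V, V + ℝw ∈ Gr_{k+1,n}^{>0}; and the vector u ∈ V^⊥ ∩ (V+ℝw)
  -- with w - u ∈ V (unique when it exists) has u_1 > 0.
  -- (u ∈ V + ℝw follows from w - u ∈ V.)
  PositivelyOriented : ∀ {k m} → Matrix k (ℕ.suc m) → Vector (ℕ.suc m) → Set (c ⊔ ℓ)
  PositivelyOriented A w =
    TotallyPositive A ×
    ¬ (w ∈span A) ×
    TotallyPositive (extend A w) ×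
    Σ (Vector _) λ u → u ∈perp A × ((λ i → w i - u i) ∈span A) × Pos (u Fin.zero)

  -- the moment-curve matrix: row j (j = 1..k) is (t_1^j, …, t_n^j)
  moment : ∀ {k n} → Vector n → Matrix k n
  moment t j i = t i ^ ℕ.suc (Fin.toℕ j)

module Submission where

-- The minors of the moment curve A = (t_i^j) and of its extension E by the row w = (1, …, 1) are
-- generalised Vandermonde determinants, positive since 0 < t₁ < ⋯ < tₙ. By Cauchy–Binet the Gram
-- determinant D = det (A Aᵀ) is a sum of squares of these minors, hence positive, and the vector
-- u = D⁻¹ · det [E ; A Eᵀ] (expanded along its vector-valued first row) satisfies
-- x · u = D⁻¹ det ([x ; A] Eᵀ) for every x. So u ⊥ V (two equal rows), w − u ∈ V (the coefficient
-- of w is D⁻¹ D = 1), and u₁ = D⁻¹ det ([e₁ ; A] Eᵀ) = D⁻¹ Σ_J Δ_{J+1}(A) Δ_{{1} ∪ (J+1)}(E) > 0,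
-- again by Cauchy–Binet. Finally w ∉ V, since otherwise u · u = w · u − (w − u) · u = 0.

open import Defs
open import Data.Nat using (ℕ; suc; _<_)
open import Data.Fin as Fin using (Fin)

open import Level using (_⊔_)
open import Algebra.Bundles using (CommutativeRing)
import Algebra.Solver.Ring.AlmostCommutativeRing as ACR
import Algebra.Solver.Ring
open import Data.Nat as ℕ using (zero)
import Data.Nat.Properties as ℕ
open import Data.Integer as ℤ using (ℤ; +_; -[1+_]; _⊖_; _◃_; ∣_∣)
import Data.Integer.Properties as ℤ
open import Data.Sign as Sign using (Sign)
open import Data.Fin using (zero; suc; punchIn; inject₁; fromℕ; toℕ)
import Data.Fin.Properties as Fin
open import Data.Vec.Functional using (_∷_; tail; removeAt; updateAt; transpose)
open import Data.Vec.Functional.Properties using (updateAt-updates; updateAt-minimal; map-updateAt)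
open import Data.Maybe using (Maybe; just; nothing)
open import Data.Product using (_,_; proj₁; proj₂)
open import Data.Sum using (_⊎_; inj₁; inj₂)
open import Data.Empty using (⊥-elim)
open import Function using (_∘_; const)
open import Relation.Nullary using (¬_; yes; no)
open import Relation.Binary.PropositionalEquality as ≡ using (_≡_)

-- Algebra.Solver.Ring needs coefficients with decidable equality; ℤ maps into every commutative ring.
module IntegerCoefficientSolver {c ℓ} (R : CommutativeRing c ℓ) where
  open CommutativeRing R
  open import Algebra.Properties.Ring ring using (-‿distribˡ-*; -‿distribʳ-*)
  open import Algebra.Properties.AbelianGroup +-abelianGroup
    using (⁻¹-∙-comm; ⁻¹-involutive; ε⁻¹≈ε)
  open import Algebra.Properties.Semiring.Mult semiring using (_×_; ×-homo-+; ×1-homo-*)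
  open import Algebra.Properties.CommutativeSemigroup +-commutativeSemigroup
    using () renaming (interchange to +-interchange)
  open import Algebra.Properties.CommutativeSemigroup *-commutativeSemigroup
    using () renaming (interchange to *-interchange)
  open import Relation.Binary.Reasoning.Setoid setoid

  ⟦_⟧ᶻ : ℤ → Carrier
  ⟦ + n ⟧ᶻ      = n × 1#
  ⟦ -[1+ n ] ⟧ᶻ = - (suc n × 1#)

  private
    ⊖-homo : ∀ m n → ⟦ m ⊖ n ⟧ᶻ ≈ m × 1# - n × 1#
    ⊖-homo m       zero    = sym (trans (+-congˡ ε⁻¹≈ε) (+-identityʳ _))
    ⊖-homo zero    (suc n) = sym (+-identityˡ _)
    ⊖-homo (suc m) (suc n) = begin
      ⟦ suc m ⊖ suc n ⟧ᶻ        ≡⟨ ≡.cong ⟦_⟧ᶻ (ℤ.[1+m]⊖[1+n]≡m⊖n m n) ⟩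
      ⟦ m ⊖ n ⟧ᶻ                ≈⟨ ⊖-homo m n ⟩
      a - b                      ≈⟨ +-identityˡ _ ⟨
      0# + (a - b)               ≈⟨ +-congʳ (-‿inverseʳ 1#) ⟨
      (1# - 1#) + (a - b)        ≈⟨ +-interchange _ _ _ _ ⟨
      (1# + a) + (- 1# - b)      ≈⟨ +-congˡ (⁻¹-∙-comm _ _) ⟩
      (1# + a) - (1# + b)        ∎
      where a = m × 1#; b = n × 1#

    +-homo : ∀ i j → ⟦ i ℤ.+ j ⟧ᶻ ≈ ⟦ i ⟧ᶻ + ⟦ j ⟧ᶻ
    +-homo (+ m)    (+ n)    = ×-homo-+ 1# m n
    +-homo (+ m)    -[1+ n ] = ⊖-homo m (suc n)
    +-homo -[1+ m ] (+ n)    = trans (⊖-homo n (suc m)) (+-comm _ _)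
    +-homo -[1+ m ] -[1+ n ] = begin
      - (suc (suc (m ℕ.+ n)) × 1#)        ≡⟨ ≡.cong (λ k → - (k × 1#)) (ℕ.+-suc (suc m) n) ⟨
      - ((suc m ℕ.+ suc n) × 1#)          ≈⟨ -‿cong (×-homo-+ 1# (suc m) (suc n)) ⟩
      - (suc m × 1# + suc n × 1#)          ≈⟨ ⁻¹-∙-comm _ _ ⟨
      - (suc m × 1#) - (suc n × 1#)        ∎

    -‿homo : ∀ i → ⟦ ℤ.- i ⟧ᶻ ≈ - ⟦ i ⟧ᶻ
    -‿homo (+ zero)  = sym ε⁻¹≈ε
    -‿homo (+ suc n) = refl
    -‿homo -[1+ n ]  = sym (⁻¹-involutive _)

    ⟦_⟧ˢ : Sign → Carrier
    ⟦ Sign.+ ⟧ˢ = 1#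
    ⟦ Sign.- ⟧ˢ = - 1#

    ◃-homo : ∀ s n → ⟦ s ◃ n ⟧ᶻ ≈ ⟦ s ⟧ˢ * (n × 1#)
    ◃-homo s       zero    = sym (zeroʳ _)
    ◃-homo Sign.+ (suc n) = sym (*-identityˡ _)
    ◃-homo Sign.- (suc n) = trans (-‿cong (sym (*-identityˡ _))) (-‿distribˡ-* _ _)

    sign-∣∣-homo : ∀ i → ⟦ i ⟧ᶻ ≈ ⟦ ℤ.sign i ⟧ˢ * (∣ i ∣ × 1#)
    sign-∣∣-homo i = trans (reflexive (≡.cong ⟦_⟧ᶻ (≡.sym (ℤ.◃-inverse i)))) (◃-homo (ℤ.sign i) ∣ i ∣)

    ⟦⟧ˢ-homo : ∀ s t → ⟦ s Sign.* t ⟧ˢ ≈ ⟦ s ⟧ˢ * ⟦ t ⟧ˢ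
    ⟦⟧ˢ-homo Sign.+ t      = sym (*-identityˡ _)
    ⟦⟧ˢ-homo Sign.- Sign.+ = sym (*-identityʳ _)
    ⟦⟧ˢ-homo Sign.- Sign.- = begin
      1#             ≈⟨ ⁻¹-involutive _ ⟨
      - - 1#         ≈⟨ -‿cong (*-identityʳ _) ⟨
      - (- 1# * 1#)  ≈⟨ -‿distribʳ-* _ _ ⟩
      - 1# * - 1#    ∎

    *-homo : ∀ i j → ⟦ i ℤ.* j ⟧ᶻ ≈ ⟦ i ⟧ᶻ * ⟦ j ⟧ᶻ
    *-homo i j = begin
      ⟦ i ℤ.* j ⟧ᶻ
        ≈⟨ ◃-homo (ℤ.sign i Sign.* ℤ.sign j) (∣ i ∣ ℕ.* ∣ j ∣) ⟩
      ⟦ ℤ.sign i Sign.* ℤ.sign j ⟧ˢ * ((∣ i ∣ ℕ.* ∣ j ∣) × 1#)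
        ≈⟨ *-cong (⟦⟧ˢ-homo (ℤ.sign i) (ℤ.sign j)) (×1-homo-* ∣ i ∣ ∣ j ∣) ⟩
      (⟦ ℤ.sign i ⟧ˢ * ⟦ ℤ.sign j ⟧ˢ) * ((∣ i ∣ × 1#) * (∣ j ∣ × 1#))
        ≈⟨ *-interchange _ _ _ _ ⟩
      (⟦ ℤ.sign i ⟧ˢ * (∣ i ∣ × 1#)) * (⟦ ℤ.sign j ⟧ˢ * (∣ j ∣ × 1#))
        ≈⟨ *-cong (sign-∣∣-homo i) (sign-∣∣-homo j) ⟨
      ⟦ i ⟧ᶻ * ⟦ j ⟧ᶻ ∎

    ℤ-homomorphism : ℤ.+-*-rawRing ACR.-Raw-AlmostCommutative⟶ ACR.fromCommutativeRing R
    ℤ-homomorphism = record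
      { ⟦_⟧ = ⟦_⟧ᶻ ; +-homo = +-homo ; *-homo = *-homo ; -‿homo = -‿homo
      ; 0-homo = refl ; 1-homo = +-identityʳ 1# }

    ⟦⟧ᶻ-≟ : ∀ i j → Maybe (⟦ i ⟧ᶻ ≈ ⟦ j ⟧ᶻ)
    ⟦⟧ᶻ-≟ i j with i ℤ.≟ j
    ... | yes ≡.refl = just refl
    ... | no _       = nothing

  open Algebra.Solver.Ring ℤ.+-*-rawRing (ACR.fromCommutativeRing R) ℤ-homomorphism ⟦⟧ᶻ-≟ public

module FiniteSums {c ℓ} (F : OrderedField c ℓ) where
  open LinAlg F hiding (zero)
  open import Algebra.Properties.CommutativeSemigroup +-commutativeSemigroup
    using (interchange)
  open import Algebra.Properties.AbelianGroup +-abelianGroup using (⁻¹-∙-comm; ε⁻¹≈ε)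
  open import Relation.Binary.Reasoning.Setoid setoid

  Σ-cong : ∀ {n} {f g : Fin n → Carrier} → (∀ i → f i ≈ g i) → Σᶠ f ≈ Σᶠ g
  Σ-cong {zero}  f≈g = refl
  Σ-cong {suc n} f≈g = +-cong (f≈g zero) (Σ-cong (λ i → f≈g (suc i)))

  Σ-zero : ∀ {n} {f : Fin n → Carrier} → (∀ i → f i ≈ 0#) → Σᶠ f ≈ 0#
  Σ-zero {zero}  f≈0 = refl
  Σ-zero {suc n} f≈0 = trans (+-cong (f≈0 zero) (Σ-zero (λ i → f≈0 (suc i)))) (+-identityˡ _)

  Σ-distrib-+ : ∀ {n} (f g : Fin n → Carrier) → Σᶠ (λ i → f i + g i) ≈ Σᶠ f + Σᶠ g
  Σ-distrib-+ {zero}  f g = sym (+-identityˡ _)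
  Σ-distrib-+ {suc n} f g =
    trans (+-congˡ (Σ-distrib-+ (λ i → f (suc i)) (λ i → g (suc i)))) (interchange _ _ _ _)

  Σ-distrib-neg : ∀ {n} (f : Fin n → Carrier) → Σᶠ (λ i → - f i) ≈ - Σᶠ f
  Σ-distrib-neg {zero}  f = sym ε⁻¹≈ε
  Σ-distrib-neg {suc n} f = trans (+-congˡ (Σ-distrib-neg (λ i → f (suc i)))) (⁻¹-∙-comm _ _)

  Σ-factorˡ : ∀ {n} a (f : Fin n → Carrier) → Σᶠ (λ i → a * f i) ≈ a * Σᶠ f
  Σ-factorˡ {zero}  a f = sym (zeroʳ _)
  Σ-factorˡ {suc n} a f = trans (+-congˡ (Σ-factorˡ a (λ i → f (suc i)))) (sym (distribˡ _ _ _))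

  Σ-factorˡ₂ : ∀ {n} a b (f : Fin n → Carrier) → Σᶠ (λ i → a * (b * f i)) ≈ a * (b * Σᶠ f)
  Σ-factorˡ₂ a b f = trans (Σ-factorˡ a (λ i → b * f i)) (*-congˡ (Σ-factorˡ b f))

  Σ-sub-*ˡ : ∀ {n} (f g : Fin n → Carrier) a → Σᶠ (λ i → f i - a * g i) ≈ Σᶠ f - a * Σᶠ g
  Σ-sub-*ˡ f g a = begin
    Σᶠ (λ i → f i - a * g i)        ≈⟨ Σ-distrib-+ f (λ i → - (a * g i)) ⟩
    Σᶠ f + Σᶠ (λ i → - (a * g i))   ≈⟨ +-congˡ (Σ-distrib-neg (λ i → a * g i)) ⟩
    Σᶠ f - Σᶠ (λ i → a * g i)       ≈⟨ +-congˡ (-‿cong (Σ-factorˡ a g)) ⟩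
    Σᶠ f - a * Σᶠ g                 ∎

  Σ-comm : ∀ {n m} (f : Fin n → Fin m → Carrier) →
           Σᶠ (λ i → Σᶠ (λ j → f i j)) ≈ Σᶠ (λ j → Σᶠ (λ i → f i j))
  Σ-comm {zero}  f = sym (Σ-zero {f = λ j → Σᶠ {zero} (λ i → f i j)} (λ _ → refl))
  Σ-comm {suc n} f = begin
    Σᶠ (f zero) + Σᶠ (λ i → Σᶠ (f (suc i)))     ≈⟨ +-congˡ (Σ-comm (λ i → f (suc i))) ⟩
    Σᶠ (f zero) + Σᶠ (λ j → Σᶠ (λ i → f (suc i) j))
      ≈⟨ Σ-distrib-+ (f zero) (λ j → Σᶠ (λ i → f (suc i) j)) ⟨
    Σᶠ (λ j → f zero j + Σᶠ (λ i → f (suc i) j)) ∎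

  Σ-*-Σ : ∀ {n m} (f : Fin n → Carrier) (g : Fin m → Carrier) →
          Σᶠ f * Σᶠ g ≈ Σᶠ (λ i → Σᶠ (λ j → f i * g j))
  Σ-*-Σ f g = begin
    Σᶠ f * Σᶠ g                      ≈⟨ *-comm _ _ ⟩
    Σᶠ g * Σᶠ f                      ≈⟨ Σ-factorˡ _ f ⟨
    Σᶠ (λ i → Σᶠ g * f i)            ≈⟨ Σ-cong (λ i → trans (*-comm _ _) (sym (Σ-factorˡ (f i) g))) ⟩
    Σᶠ (λ i → Σᶠ (λ j → f i * g j))  ∎

  Σ-init-last : ∀ {n} (f : Fin (suc n) → Carrier) → Σᶠ f ≈ Σᶠ (λ i → f (inject₁ i)) + f (fromℕ n)
  Σ-init-last {zero}  f = trans (+-identityʳ _) (sym (+-identityˡ _))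
  Σ-init-last {suc n} f = trans (+-congˡ (Σ-init-last (λ i → f (suc i)))) (sym (+-assoc _ _ _))

  δ : ∀ {n} → Fin n → Fin n → Carrier
  δ zero    zero    = 1#
  δ zero    (suc _) = 0#
  δ (suc i) zero    = 0#
  δ (suc i) (suc j) = δ i j

  Σ-δ : ∀ {n} (i : Fin n) (f : Fin n → Carrier) → Σᶠ (λ j → δ i j * f j) ≈ f i
  Σ-δ zero    f = trans (+-cong (*-identityˡ _) (Σ-zero (λ j → zeroˡ (f (suc j))))) (+-identityʳ _)
  Σ-δ (suc i) f = trans (+-cong (zeroˡ _) (Σ-δ i (λ j → f (suc j)))) (+-identityˡ _)

module Positivity {c ℓ} (F : OrderedField c ℓ) where
  open LinAlg F hiding (zero)
  open IntegerCoefficientSolver commutativeRing using (solve; _:=_; _:*_; :-_)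
  open import Algebra.Properties.Ring ring using (-‿distribʳ-*)

  NonNeg : Carrier → Set ℓ
  NonNeg x = Pos x ⊎ x ≈ 0#

  Pos⇒≉0 : ∀ {x} → Pos x → ¬ (x ≈ 0#)
  Pos⇒≉0 px x≈0 = Pos-irrefl (Pos-resp x≈0 px)

  NonNeg-square : ∀ x → NonNeg (x * x)
  NonNeg-square x with Pos-trichotomy x
  ... | inj₁ px        = inj₁ (Pos-* px px)
  ... | inj₂ (inj₁ x≈0) = inj₂ (trans (*-congˡ x≈0) (zeroʳ _))
  ... | inj₂ (inj₂ p-x) =
    inj₁ (Pos-resp (solve 1 (λ a → (:- a) :* (:- a) := a :* a) refl x) (Pos-* p-x p-x))

  Pos-1# : Pos 1#
  Pos-1# with NonNeg-square 1#
  ... | inj₁ p   = Pos-resp (*-identityʳ 1#) p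
  ... | inj₂ 1≈0 = ⊥-elim (nontrivial (trans (sym (*-identityʳ 1#)) 1≈0))

  Pos-^ : ∀ {x} n → Pos x → Pos (x ^ n)
  Pos-^ zero    px = Pos-1#
  Pos-^ (suc n) px = Pos-* px (Pos-^ n px)

  Pos-inverse : ∀ {x y} → Pos x → x * y ≈ 1# → Pos y
  Pos-inverse {x} {y} px xy≈1 with Pos-trichotomy y
  ... | inj₁ py         = py
  ... | inj₂ (inj₁ y≈0) = ⊥-elim (nontrivial (trans (sym xy≈1) (trans (*-congˡ y≈0) (zeroʳ _))))
  ... | inj₂ (inj₂ p-y) =
    ⊥-elim (Pos-asym Pos-1# (Pos-resp (trans (sym (-‿distribʳ-* _ _)) (-‿cong xy≈1)) (Pos-* px p-y)))

  NonNeg-+ : ∀ {x y} → NonNeg x → NonNeg y → NonNeg (x + y)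
  NonNeg-+ (inj₁ px)  (inj₁ py)  = inj₁ (Pos-+ px py)
  NonNeg-+ (inj₁ px)  (inj₂ y≈0) = inj₁ (Pos-resp (sym (trans (+-congˡ y≈0) (+-identityʳ _))) px)
  NonNeg-+ (inj₂ x≈0) (inj₁ py)  = inj₁ (Pos-resp (sym (trans (+-congʳ x≈0) (+-identityˡ _))) py)
  NonNeg-+ (inj₂ x≈0) (inj₂ y≈0) = inj₂ (trans (+-cong x≈0 y≈0) (+-identityʳ _))

  Pos-+-NonNeg : ∀ {x y} → Pos x → NonNeg y → Pos (x + y)
  Pos-+-NonNeg px (inj₁ py)  = Pos-+ px py
  Pos-+-NonNeg px (inj₂ y≈0) = Pos-resp (sym (trans (+-congˡ y≈0) (+-identityʳ _))) px

  NonNeg-Σ-squares : ∀ {n} (v : Fin n → Carrier) → NonNeg (Σᶠ (λ i → v i * v i))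
  NonNeg-Σ-squares {zero}  v = inj₂ refl
  NonNeg-Σ-squares {suc n} v = NonNeg-+ (NonNeg-square (v zero)) (NonNeg-Σ-squares (λ i → v (suc i)))

module Determinants {c ℓ} (F : OrderedField c ℓ) where
  open LinAlg F hiding (zero)
  open FiniteSums F
  open IntegerCoefficientSolver commutativeRing using (solve; _:=_; _:+_; _:*_; :-_; _:-_; con)
  open import Algebra.Properties.Ring ring using (-‿distribˡ-*)
  open import Algebra.Properties.Group +-group using (inverseʳ-unique)
  open import Algebra.Properties.AbelianGroup +-abelianGroup using (ε⁻¹≈ε)
  open import Relation.Binary.Reasoning.Setoid setoid

  sgn : ∀ {n} → Fin n → Carrier
  sgn j = sign (toℕ j)

  sign-square : ∀ n → sign n * sign n ≈ 1#
  sign-square zero    = *-identityˡ _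
  sign-square (suc n) = trans (solve 1 (λ a → (:- a) :* (:- a) := a :* a) refl (sign n)) (sign-square n)

  sgn-cancel : ∀ {n} (r : Fin n) x → sgn r * (sgn r * x) ≈ x
  sgn-cancel r x = trans (sym (*-assoc _ _ _)) (trans (*-congʳ (sign-square (toℕ r))) (*-identityˡ x))

  distribˡ₂ : ∀ s x y z → s * (x * (y + z)) ≈ s * (x * y) + s * (x * z)
  distribˡ₂ s x y z = trans (*-congˡ (distribˡ x y z)) (distribˡ s _ _)

  -- det (v ∷ R) unfolds to Σᶠ (cofactor v R)
  cofactor : ∀ {m} → Vector (suc m) → Matrix m (suc m) → Fin (suc m) → Carrier
  cofactor v R j = sgn j * (v j * det (λ r s → R r (punchIn j s)))

  expansion-cong : ∀ {m} (v : Vector m) {D D′ : Vector m} → (∀ j → D j ≈ D′ j) →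
                   Σᶠ (λ j → sgn j * (v j * D j)) ≈ Σᶠ (λ j → sgn j * (v j * D′ j))
  expansion-cong v D≈D′ = Σ-cong (λ j → *-congˡ (*-congˡ (D≈D′ j)))

  det-cong : ∀ {m} {M N : Matrix m m} → (∀ r s → M r s ≈ N r s) → det M ≈ det N
  det-cong {zero}  M≈N = refl
  det-cong {suc m} {M} {N} M≈N =
    Σ-cong {f = cofactor (M zero) (tail M)} {g = cofactor (N zero) (tail N)}
           (λ j → *-congˡ (*-cong (M≈N zero j) (det-cong (λ r s → M≈N (suc r) (punchIn j s)))))

  det-cong-≡ : ∀ {m} {M N : Matrix m m} → (∀ r s → M r s ≡ N r s) → det M ≈ det N
  det-cong-≡ M≡N = det-cong (λ r s → reflexive (M≡N r s))

  det-head-+ : ∀ {m} (u v : Vector (suc m)) R →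
               det ((λ j → u j + v j) ∷ R) ≈ det (u ∷ R) + det (v ∷ R)
  det-head-+ u v R = trans
    (Σ-cong {f = cofactor (λ j → u j + v j) R}
            (λ j → solve 4 (λ s a b d → s :* ((a :+ b) :* d) := s :* (a :* d) :+ s :* (b :* d))
                           refl (sgn j) (u j) (v j) (det (λ r s → R r (punchIn j s)))))
    (Σ-distrib-+ (cofactor u R) (cofactor v R))

  det-head-zero : ∀ {m} (v : Vector (suc m)) R → (∀ j → v j ≈ 0#) → det (v ∷ R) ≈ 0#
  det-head-zero v R v≈0 =
    Σ-zero {f = cofactor v R} (λ j → trans (*-congˡ (trans (*-congʳ (v≈0 j)) (zeroˡ _))) (zeroʳ _))

  det-head-δ₀ : ∀ {m} (R : Matrix m (suc m)) → det (δ zero ∷ R) ≈ det (λ r s → R r (suc s))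
  det-head-δ₀ R = trans
    (+-cong (trans (*-identityˡ _) (*-identityˡ _))
            (Σ-zero (λ j → trans (*-congˡ (zeroˡ (det (λ r s → R r (punchIn (suc j) s))))) (zeroʳ (sgn (suc j))))))
    (+-identityʳ _)

  det-neg : ∀ {m} (M : Matrix m m) → det (λ r s → - M r s) ≈ sign m * det M
  det-neg {zero}  M = sym (*-identityˡ _)
  det-neg {suc m} M = begin
    Σᶠ (λ j → sgn j * (- M zero j * det (λ r s → - M (suc r) (punchIn j s))))
      ≈⟨ expansion-cong (λ j → - M zero j) (λ j → det-neg (λ r s → M (suc r) (punchIn j s))) ⟩
    Σᶠ (λ j → sgn j * (- M zero j * (sign m * D j)))
      ≈⟨ Σ-cong (λ j → solve 4 (λ s a t d → s :* ((:- a) :* (t :* d)) := (:- t) :* (s :* (a :* d)))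
                              refl (sgn j) (M zero j) (sign m) (D j)) ⟩
    Σᶠ (λ j → - sign m * (sgn j * (M zero j * D j)))
      ≈⟨ Σ-factorˡ _ (cofactor (M zero) (tail M)) ⟩
    - sign m * det M ∎
    where
    D : Fin (suc m) → Carrier
    D j = det (λ r s → M (suc r) (punchIn j s))

  -- Expanding det (v ∷ v ∷ R) along its first two rows gives this sum with Φ f = det (λ r s → R r (f s)).
  alternatingSum : ∀ {m} → Vector (suc (suc m)) → ((Fin m → Fin (suc (suc m))) → Carrier) → Carrier
  alternatingSum v Φ =
    Σᶠ (λ a → sgn a * (v a * Σᶠ (λ b → sgn b * (v (punchIn a b) * Φ (punchIn a ∘ punchIn b)))))

  offColumnZeroSum : ∀ {m} → Vector (suc (suc m)) → ((Fin m → Fin (suc (suc m))) → Carrier) → Carrier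
  offColumnZeroSum v Φ =
    Σᶠ (λ a → sgn (suc a) * (v (suc a) * Σᶠ (λ b → sgn (suc b) *
      (v (punchIn (suc a) (suc b)) * Φ (punchIn (suc a) ∘ punchIn (suc b))))))

  alternatingSum≈offColumnZeroSum : ∀ {m} v (Φ : (Fin m → Fin (suc (suc m))) → Carrier) →
                                    alternatingSum v Φ ≈ offColumnZeroSum v Φ
  alternatingSum≈offColumnZeroSum {m} v Φ = begin
    X + Σᶠ (λ a → sgn (suc a) * (v (suc a) * (Y a + Z a)))
      ≈⟨ +-congˡ (Σ-cong (λ a → distribˡ₂ (sgn (suc a)) (v (suc a)) (Y a) (Z a))) ⟩
    X + Σᶠ (λ a → sgn (suc a) * (v (suc a) * Y a) + sgn (suc a) * (v (suc a) * Z a))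
      ≈⟨ +-congˡ (Σ-distrib-+ (λ a → sgn (suc a) * (v (suc a) * Y a)) (λ a → sgn (suc a) * (v (suc a) * Z a))) ⟩
    X + (Σᶠ (λ a → sgn (suc a) * (v (suc a) * Y a)) + offColumnZeroSum v Φ)
      ≈⟨ +-assoc _ _ _ ⟨
    (X + Σᶠ (λ a → sgn (suc a) * (v (suc a) * Y a))) + offColumnZeroSum v Φ
      ≈⟨ +-congʳ columnZero-cancels ⟩
    0# + offColumnZeroSum v Φ  ≈⟨ +-identityˡ _ ⟩
    offColumnZeroSum v Φ ∎
    where
    φ : Fin (suc m) → Carrier
    φ b = Φ (suc ∘ punchIn b)
    X : Carrier
    X = sgn {suc (suc m)} zero * (v zero * Σᶠ (λ b → sgn b * (v (suc b) * φ b)))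
    Y Z : Fin (suc m) → Carrier
    Y a = sgn {suc m} zero * (v zero * φ a)
    Z a = Σᶠ (λ b → sgn (suc b) * (v (punchIn (suc a) (suc b)) * Φ (punchIn (suc a) ∘ punchIn (suc b))))

    columnZero-cancels : X + Σᶠ (λ a → sgn (suc a) * (v (suc a) * Y a)) ≈ 0#
    columnZero-cancels = begin
      X + Σᶠ (λ a → sgn (suc a) * (v (suc a) * Y a))
        ≈⟨ +-congʳ (trans (*-identityˡ _) (sym (Σ-factorˡ (v zero) (λ b → sgn b * (v (suc b) * φ b))))) ⟩
      Σᶠ (λ b → v zero * (sgn b * (v (suc b) * φ b))) + Σᶠ (λ a → sgn (suc a) * (v (suc a) * Y a))
        ≈⟨ Σ-distrib-+ (λ b → v zero * (sgn b * (v (suc b) * φ b))) (λ a → sgn (suc a) * (v (suc a) * Y a)) ⟨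
      Σᶠ (λ b → v zero * (sgn b * (v (suc b) * φ b)) + sgn (suc b) * (v (suc b) * Y b))
        ≈⟨ Σ-zero (λ b → trans (+-congˡ (*-congˡ (*-congˡ (*-identityˡ _))))
             (solve 4 (λ w s x p → w :* (s :* (x :* p)) :+ (:- s) :* (x :* (w :* p)) := con (+ 0))
                    refl (v zero) (sgn b) (v (suc b)) (φ b))) ⟩
      0# ∎

  alternatingSum-zero : ∀ m (v : Vector (suc (suc m))) (Φ : (Fin m → Fin (suc (suc m))) → Carrier) →
                        (∀ f g → (∀ s → f s ≡ g s) → Φ f ≈ Φ g) → alternatingSum v Φ ≈ 0#
  alternatingSum-zero zero v Φ Φ-cong =
    trans (alternatingSum≈offColumnZeroSum v Φ) (Σ-zero (λ a → trans (*-congˡ (zeroʳ (v (suc a)))) (zeroʳ (sgn (suc a)))))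
  alternatingSum-zero (suc m) v Φ Φ-cong = begin
    alternatingSum v Φ                ≈⟨ alternatingSum≈offColumnZeroSum v Φ ⟩
    offColumnZeroSum v Φ              ≈⟨ Σ-cong reindex ⟩
    alternatingSum (tail v) Ψ         ≈⟨ alternatingSum-zero m (tail v) Ψ (λ f g f≗g → Φ-cong _ _ (lift-cong f≗g)) ⟩
    0# ∎
    where
    Ψ : (Fin m → Fin (suc (suc m))) → Carrier
    Ψ f = Φ (Fin.lift 1 f)
    lift-cong : ∀ {f g : Fin m → Fin (suc (suc m))} → (∀ s → f s ≡ g s) → ∀ s → Fin.lift 1 f s ≡ Fin.lift 1 g s
    lift-cong f≗g zero    = ≡.refl
    lift-cong f≗g (suc s) = ≡.cong suc (f≗g s)
    Φ-lift : ∀ a b → Φ (punchIn (suc a) ∘ punchIn (suc b)) ≈ Ψ (punchIn a ∘ punchIn b)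
    Φ-lift a b = Φ-cong _ _ λ { zero → ≡.refl ; (suc s) → ≡.refl }
    Ψ-term : Fin (suc (suc m)) → Fin (suc m) → Carrier
    Ψ-term a b = sgn b * (v (suc (punchIn a b)) * Ψ (punchIn a ∘ punchIn b))
    reindex : ∀ a → sgn (suc a) * (v (suc a) * Σᶠ (λ b → sgn (suc b) *
                      (v (punchIn (suc a) (suc b)) * Φ (punchIn (suc a) ∘ punchIn (suc b)))))
                    ≈ sgn a * (v (suc a) * Σᶠ (Ψ-term a))
    reindex a = begin
      - sgn a * (v (suc a) * Σᶠ (λ b → - sgn b * (v (suc (punchIn a b)) * Φ (punchIn (suc a) ∘ punchIn (suc b)))))
        ≈⟨ *-congˡ (*-congˡ (Σ-cong (λ b → trans (*-congˡ (*-congˡ {v (suc (punchIn a b))} (Φ-lift a b)))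
                                                 (sym (-‿distribˡ-* (sgn b) _))))) ⟩
      - sgn a * (v (suc a) * Σᶠ (λ b → - Ψ-term a b))
        ≈⟨ *-congˡ (*-congˡ (Σ-distrib-neg (Ψ-term a))) ⟩
      - sgn a * (v (suc a) * - Σᶠ (Ψ-term a))
        ≈⟨ solve 3 (λ s x y → (:- s) :* (x :* (:- y)) := s :* (x :* y)) refl (sgn a) (v (suc a)) (Σᶠ (Ψ-term a)) ⟩
      sgn a * (v (suc a) * Σᶠ (Ψ-term a)) ∎

  det-equalRows₀₁ : ∀ {m} (M : Matrix (suc (suc m)) (suc (suc m))) →
                    (∀ j → M zero j ≈ M (suc zero) j) → det M ≈ 0#
  det-equalRows₀₁ {m} M M₀≈M₁ = begin
    det M                                    ≈⟨ det-cong equalRows ⟩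
    det (M zero ∷ M zero ∷ tail (tail M))    ≈⟨ alternatingSum-zero m (M zero) Φ Φ-cong ⟩
    0# ∎
    where
    Φ : (Fin m → Fin (suc (suc m))) → Carrier
    Φ f = det (λ r s → M (suc (suc r)) (f s))
    Φ-cong : ∀ f g → (∀ s → f s ≡ g s) → Φ f ≈ Φ g
    Φ-cong f g f≗g = det-cong-≡ (λ r s → ≡.cong (M (suc (suc r))) (f≗g s))
    equalRows : ∀ r s → M r s ≈ (M zero ∷ M zero ∷ tail (tail M)) r s
    equalRows zero          s = refl
    equalRows (suc zero)    s = sym (M₀≈M₁ s)
    equalRows (suc (suc r)) s = refl

  TransposeInvariant : ℕ → Set (c ⊔ ℓ)
  TransposeInvariant n = ∀ (M : Matrix n n) → det (transpose M) ≈ det M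

  -- Both sides are expanded into the same double sum over the entries M 0 (j+1) and M (i+1) 0.
  transposeInvariant-step : ∀ n → TransposeInvariant (suc n) → TransposeInvariant n →
                            TransposeInvariant (suc (suc n))
  transposeInvariant-step n tr₁ tr₀ M = +-cong corner (trans expandᵀ (sym expand))
    where
    X : Fin (suc n) → Fin (suc n) → Carrier
    X i j = det (λ r s → M (suc (punchIn i r)) (suc (punchIn j s)))
    Q : Fin (suc n) → Fin (suc n) → Carrier
    Q i j = - (sgn j * sgn i) * (M zero (suc j) * (M (suc i) zero * X i j))
    corner : sgn {suc (suc n)} zero * (M zero zero * det (λ r s → M (suc s) (suc r)))
           ≈ sgn {suc (suc n)} zero * (M zero zero * det (λ r s → M (suc r) (suc s)))
    corner = *-congˡ (*-congˡ (tr₁ (λ r s → M (suc r) (suc s))))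
    minor-expand : ∀ j → det (λ r s → M (suc r) (punchIn (suc j) s)) ≈ Σᶠ (λ i → sgn i * (M (suc i) zero * X i j))
    minor-expand j = trans (sym (tr₁ (λ r s → M (suc r) (punchIn (suc j) s))))
      (expansion-cong (λ i → M (suc i) zero) (λ i → tr₀ (λ r s → M (suc (punchIn i r)) (suc (punchIn j s)))))
    expand : Σᶠ (λ j → sgn (suc j) * (M zero (suc j) * det (λ r s → M (suc r) (punchIn (suc j) s))))
             ≈ Σᶠ (λ j → Σᶠ (λ i → Q i j))
    expand = Σ-cong (λ j → begin
      sgn (suc j) * (M zero (suc j) * det (λ r s → M (suc r) (punchIn (suc j) s)))
        ≈⟨ *-congˡ (*-congˡ (minor-expand j)) ⟩
      sgn (suc j) * (M zero (suc j) * Σᶠ (λ i → sgn i * (M (suc i) zero * X i j)))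
        ≈⟨ Σ-factorˡ₂ _ _ (λ i → sgn i * (M (suc i) zero * X i j)) ⟨
      Σᶠ (λ i → sgn (suc j) * (M zero (suc j) * (sgn i * (M (suc i) zero * X i j))))
        ≈⟨ Σ-cong (λ i → solve 5 (λ sj si a b x → (:- sj) :* (a :* (si :* (b :* x))) := (:- (sj :* si)) :* (a :* (b :* x)))
                                refl (sgn j) (sgn i) (M zero (suc j)) (M (suc i) zero) (X i j)) ⟩
      Σᶠ (λ i → Q i j) ∎)
    expandᵀ : Σᶠ (λ i → sgn (suc i) * (M (suc i) zero * det (λ r s → M (punchIn (suc i) s) (suc r))))
              ≈ Σᶠ (λ j → Σᶠ (λ i → Q i j))
    expandᵀ = begin
      Σᶠ (λ i → sgn (suc i) * (M (suc i) zero * det (λ r s → M (punchIn (suc i) s) (suc r))))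
        ≈⟨ Σ-cong (λ i → begin
             sgn (suc i) * (M (suc i) zero * det (λ r s → M (punchIn (suc i) s) (suc r)))
               ≈⟨ *-congˡ (*-congˡ (tr₁ (λ r s → M (punchIn (suc i) r) (suc s)))) ⟩
             sgn (suc i) * (M (suc i) zero * Σᶠ (λ j → sgn j * (M zero (suc j) * X i j)))
               ≈⟨ Σ-factorˡ₂ _ _ (λ j → sgn j * (M zero (suc j) * X i j)) ⟨
             Σᶠ (λ j → sgn (suc i) * (M (suc i) zero * (sgn j * (M zero (suc j) * X i j))))
               ≈⟨ Σ-cong (λ j → solve 5 (λ sj si a b x → (:- si) :* (b :* (sj :* (a :* x)))
                                                      := (:- (sj :* si)) :* (a :* (b :* x)))
                                       refl (sgn j) (sgn i) (M zero (suc j)) (M (suc i) zero) (X i j)) ⟩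
             Σᶠ (λ j → Q i j) ∎) ⟩
      Σᶠ (λ i → Σᶠ (λ j → Q i j)) ≈⟨ Σ-comm Q ⟩
      Σᶠ (λ j → Σᶠ (λ i → Q i j)) ∎

  transposeInvariant : ∀ n → TransposeInvariant n
  transposeInvariant zero          M = refl
  transposeInvariant (suc zero)    M = refl
  transposeInvariant (suc (suc n)) =
    transposeInvariant-step n (transposeInvariant (suc n)) (transposeInvariant n)

  det-transpose : ∀ {n} (M : Matrix n n) → det (transpose M) ≈ det M
  det-transpose {n} = transposeInvariant n

  det-expandColumn₀ : ∀ {n} (M : Matrix (suc n) (suc n)) →
                      det M ≈ Σᶠ (λ r → sgn r * (M r zero * det (λ a b → M (punchIn r a) (suc b))))
  det-expandColumn₀ M = trans (sym (det-transpose M))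
    (expansion-cong (λ r → M r zero) (λ r → det-transpose (λ a b → M (punchIn r a) (suc b))))

  det-second-+ : ∀ {m} p q q′ (R : Matrix m (suc (suc m))) →
                 det (p ∷ (λ j → q j + q′ j) ∷ R) ≈ det (p ∷ q ∷ R) + det (p ∷ q′ ∷ R)
  det-second-+ {m} p q q′ R = trans
    (Σ-cong {f = cofactor p ((λ j → q j + q′ j) ∷ R)} (λ j →
       trans (*-congˡ (*-congˡ (det-head-+ (q ∘ punchIn j) (q′ ∘ punchIn j) (λ r s → R r (punchIn j s)))))
             (distribˡ₂ (sgn j) (p j) (minor q j) (minor q′ j))))
    (Σ-distrib-+ (cofactor p (q ∷ R)) (cofactor p (q′ ∷ R)))
    where
    minor : Vector (suc (suc m)) → Fin (suc (suc m)) → Carrier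
    minor v j = det (v ∘ punchIn j ∷ λ r s → R r (punchIn j s))

  -- The usual polarisation: expand det ((p + q) ∷ (p + q) ∷ R) = 0 by linearity in both rows.
  det-swap₀₁ : ∀ {m} p q (R : Matrix m (suc (suc m))) → det (q ∷ p ∷ R) ≈ - det (p ∷ q ∷ R)
  det-swap₀₁ p q R = inverseʳ-unique _ _ (begin
    det (p ∷ q ∷ R) + det (q ∷ p ∷ R)
      ≈⟨ +-cong (+-identityˡ _) (+-identityʳ _) ⟨
    (0# + det (p ∷ q ∷ R)) + (det (q ∷ p ∷ R) + 0#)
      ≈⟨ +-cong (+-congʳ (det-equalRows₀₁ (p ∷ p ∷ R) (λ _ → refl)))
                (+-congˡ (det-equalRows₀₁ (q ∷ q ∷ R) (λ _ → refl))) ⟨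
    (det (p ∷ p ∷ R) + det (p ∷ q ∷ R)) + (det (q ∷ p ∷ R) + det (q ∷ q ∷ R))
      ≈⟨ +-cong (det-second-+ p p q R) (det-second-+ q p q R) ⟨
    det (p ∷ p+q ∷ R) + det (q ∷ p+q ∷ R)
      ≈⟨ det-head-+ p q (p+q ∷ R) ⟨
    det (p+q ∷ p+q ∷ R)
      ≈⟨ det-equalRows₀₁ (p+q ∷ p+q ∷ R) (λ _ → refl) ⟩
    0# ∎)
    where
    p+q : Vector (suc (suc _))
    p+q j = p j + q j

  det-rotate : ∀ {m} (r : Fin (suc m)) (M : Matrix (suc m) (suc m)) →
               det (M r ∷ removeAt M r) ≈ sgn r * det M
  det-rotate zero M = sym (*-identityˡ _)
  det-rotate {suc m} (suc r) M = begin
    det (M (suc r) ∷ removeAt M (suc r))    ≈⟨ det-cong-≡ rows ⟩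
    det (M (suc r) ∷ M zero ∷ R)             ≈⟨ det-swap₀₁ (M zero) (M (suc r)) R ⟩
    - det (M zero ∷ M (suc r) ∷ R)           ≈⟨ -‿cong rotateTail ⟩
    - (sgn r * det M)                        ≈⟨ -‿distribˡ-* _ _ ⟩
    sgn (suc r) * det M ∎
    where
    R : Matrix m (suc (suc m))
    R = removeAt (tail M) r
    rows : ∀ a b → (M (suc r) ∷ removeAt M (suc r)) a b ≡ (M (suc r) ∷ M zero ∷ R) a b
    rows zero          b = ≡.refl
    rows (suc zero)    b = ≡.refl
    rows (suc (suc a)) b = ≡.refl
    D : Fin (suc (suc m)) → Carrier
    D j = det (λ a b → M (suc a) (punchIn j b))
    minor≡minorRotated : ∀ j a b → (M (suc r) ∷ R) a (punchIn j b)
                                   ≡ ((λ b → M (suc r) (punchIn j b)) ∷ removeAt (λ a b → M (suc a) (punchIn j b)) r) a b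
    minor≡minorRotated j zero    b = ≡.refl
    minor≡minorRotated j (suc a) b = ≡.refl
    rotateTail : det (M zero ∷ M (suc r) ∷ R) ≈ sgn r * det M
    rotateTail = begin
      det (M zero ∷ M (suc r) ∷ R)
        ≈⟨ expansion-cong (M zero) (λ j → trans (det-cong-≡ (minor≡minorRotated j))
                                                (det-rotate r (λ a b → M (suc a) (punchIn j b)))) ⟩
      Σᶠ (λ j → sgn j * (M zero j * (sgn r * D j)))
        ≈⟨ Σ-cong (λ j → solve 4 (λ s a t d → s :* (a :* (t :* d)) := t :* (s :* (a :* d)))
                                refl (sgn j) (M zero j) (sgn r) (D j)) ⟩
      Σᶠ (λ j → sgn r * (sgn j * (M zero j * D j)))
        ≈⟨ Σ-factorˡ (sgn r) (cofactor (M zero) (tail M)) ⟩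
      sgn r * det M ∎

  det-equalRows₀ : ∀ {m} (M : Matrix (suc m) (suc m)) (r : Fin m) →
                   (∀ j → M zero j ≈ M (suc r) j) → det M ≈ 0#
  det-equalRows₀ {suc m} M r M₀≈Mᵣ = begin
    det M                                            ≈⟨ sgn-cancel (suc r) (det M) ⟨
    sgn (suc r) * (sgn (suc r) * det M)              ≈⟨ *-congˡ (det-rotate (suc r) M) ⟨
    sgn (suc r) * det (M (suc r) ∷ removeAt M (suc r))
      ≈⟨ *-congˡ (det-equalRows₀₁ (M (suc r) ∷ removeAt M (suc r)) (λ j → sym (M₀≈Mᵣ j))) ⟩
    sgn (suc r) * 0#                                 ≈⟨ zeroʳ _ ⟩
    0# ∎

  subtractNext : ∀ {n l} → Carrier → Matrix (suc n) l → Matrix (suc n) l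
  subtractNext {zero}  c M zero    = M zero
  subtractNext {suc n} c M zero    = λ j → M zero j - c * M (suc zero) j
  subtractNext {suc n} c M (suc r) = subtractNext c (tail M) r

  subtractNext-columns : ∀ {n l l′} c (M : Matrix (suc n) l) (f : Fin l′ → Fin l) r b →
                         subtractNext c M r (f b) ≡ subtractNext c (λ i s → M i (f s)) r b
  subtractNext-columns {zero}  c M f zero    b = ≡.refl
  subtractNext-columns {suc n} c M f zero    b = ≡.refl
  subtractNext-columns {suc n} c M f (suc r) b = subtractNext-columns c (tail M) f r b

  subtractNext-inject₁ : ∀ {n l} c (M : Matrix (suc n) l) (r : Fin n) j →
                         subtractNext c M (inject₁ r) j ≡ M (inject₁ r) j - c * M (suc r) j
  subtractNext-inject₁ {suc n} c M zero    j = ≡.refl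
  subtractNext-inject₁ {suc n} c M (suc r) j = subtractNext-inject₁ c (tail M) r j

  subtractNext-last : ∀ {n l} c (M : Matrix (suc n) l) j → subtractNext c M (fromℕ n) j ≡ M (fromℕ n) j
  subtractNext-last {zero}  c M j = ≡.refl
  subtractNext-last {suc n} c M j = subtractNext-last c (tail M) j

  det-subtractNext : ∀ {n} c (M : Matrix (suc n) (suc n)) → det (subtractNext c M) ≈ det M
  det-subtractNext {zero}  c M = refl
  det-subtractNext {suc n} c M = begin
    det (subtractNext c M)
      ≈⟨ Σ-cong (λ j → trans (*-congˡ (*-congˡ (trans (det-cong-≡ (subtractNext-columns c (tail M) (punchIn j)))
                                                       (det-subtractNext c (λ a b → M (suc a) (punchIn j b))))))
                             (solve 5 (λ s a b c d → s :* ((a :- c :* b) :* d) := s :* (a :* d) :- c :* (s :* (b :* d)))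
                                    refl (sgn j) (M zero j) (M (suc zero) j) c (D j))) ⟩
    Σᶠ (λ j → cofactor (M zero) (tail M) j - c * cofactor (M (suc zero)) (tail M) j)
      ≈⟨ Σ-sub-*ˡ (cofactor (M zero) (tail M)) (cofactor (M (suc zero)) (tail M)) c ⟩
    det M - c * det (M (suc zero) ∷ tail M)
      ≈⟨ +-congˡ (-‿cong (*-congˡ (det-equalRows₀₁ (M (suc zero) ∷ tail M) (λ _ → refl)))) ⟩
    det M - c * 0#
      ≈⟨ trans (+-congˡ (trans (-‿cong (zeroʳ c)) ε⁻¹≈ε)) (+-identityʳ _) ⟩
    det M ∎
    where
    D : Fin (suc (suc n)) → Carrier
    D j = det (λ a b → M (suc a) (punchIn j b))

punchIn-fromℕ : ∀ n (a : Fin n) → punchIn (fromℕ n) a ≡ inject₁ a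
punchIn-fromℕ (suc n) zero    = ≡.refl
punchIn-fromℕ (suc n) (suc a) = ≡.cong suc (punchIn-fromℕ n a)

module Vandermonde {c ℓ} (F : OrderedField c ℓ) where
  open LinAlg F hiding (zero)
  open FiniteSums F
  open Positivity F
  open Determinants F
  open IntegerCoefficientSolver commutativeRing using (solve; _:=_; _:*_; :-_; _:-_; con)
  open import Algebra.Properties.Ring ring using (-‿distribˡ-*)
  open import Algebra.Properties.AbelianGroup +-abelianGroup using (ε⁻¹≈ε)
  open import Relation.Binary.Reasoning.Setoid setoid

  vandermonde : ∀ {m} → Vector m → Vector m → Matrix m m
  vandermonde x g r s = g s * (x s ^ toℕ r)

  -- Subtracting x₀⁻¹ times each row from the row above clears column 0 except in the last row.
  det-vandermonde-step : ∀ {n} (x g : Vector (suc n)) x₀⁻¹ → x zero * x₀⁻¹ ≈ 1# →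
    det (vandermonde x g)
      ≈ (g zero * x zero ^ n) * det (vandermonde (tail x) (λ s → g (suc s) * (x₀⁻¹ * x (suc s) - 1#)))
  det-vandermonde-step {n} x g x₀⁻¹ x₀x₀⁻¹≈1 = begin
    det V                                      ≈⟨ det-subtractNext x₀⁻¹ V ⟨
    det V′                                     ≈⟨ det-expandColumn₀ V′ ⟩
    Σᶠ term                                    ≈⟨ Σ-init-last term ⟩
    Σᶠ (λ i → term (inject₁ i)) + term (fromℕ n)  ≈⟨ +-cong (Σ-zero initTerm-zero) lastTerm ⟩
    0# + (g zero * x zero ^ n) * det W         ≈⟨ +-identityˡ _ ⟩
    (g zero * x zero ^ n) * det W              ∎
    where
    V V′ : Matrix (suc n) (suc n)
    V  = vandermonde x g
    V′ = subtractNext x₀⁻¹ V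
    W : Matrix n n
    W = vandermonde (tail x) (λ s → g (suc s) * (x₀⁻¹ * x (suc s) - 1#))
    term : Fin (suc n) → Carrier
    term r = sgn r * (V′ r zero * det (λ a b → V′ (punchIn r a) (suc b)))
    entry : ∀ r s → V′ (inject₁ r) s ≈ - (g s * (x₀⁻¹ * x s - 1#)) * x s ^ toℕ r
    entry r s = begin
      V′ (inject₁ r) s
        ≡⟨ subtractNext-inject₁ x₀⁻¹ V r s ⟩
      g s * x s ^ toℕ (inject₁ r) - x₀⁻¹ * (g s * (x s * x s ^ toℕ r))
        ≡⟨ ≡.cong (λ k → g s * x s ^ k - x₀⁻¹ * (g s * (x s * x s ^ toℕ r))) (Fin.toℕ-inject₁ r) ⟩
      g s * x s ^ toℕ r - x₀⁻¹ * (g s * (x s * x s ^ toℕ r))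
        -- the solver denotes the constant 1 by 1 × 1# = 1# + 0#
        ≈⟨ solve 4 (λ g p c y → g :* p :- c :* (g :* (y :* p)) := (:- (g :* (c :* y :- con (+ 1)))) :* p)
                 refl (g s) (x s ^ toℕ r) x₀⁻¹ (x s) ⟩
      - (g s * (x₀⁻¹ * x s - (1# + 0#))) * x s ^ toℕ r
        ≈⟨ *-congʳ (-‿cong (*-congˡ (+-congˡ (-‿cong (+-identityʳ 1#))))) ⟩
      - (g s * (x₀⁻¹ * x s - 1#)) * x s ^ toℕ r ∎
    g₀-vanishes : g zero * (x₀⁻¹ * x zero - 1#) ≈ 0#
    g₀-vanishes = begin
      g zero * (x₀⁻¹ * x zero - 1#)  ≈⟨ *-congˡ (+-congʳ (trans (*-comm _ _) x₀x₀⁻¹≈1)) ⟩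
      g zero * (1# - 1#)             ≈⟨ *-congˡ (-‿inverseʳ 1#) ⟩
      g zero * 0#                    ≈⟨ zeroʳ _ ⟩
      0# ∎
    initTerm-zero : ∀ i → term (inject₁ i) ≈ 0#
    initTerm-zero i = begin
      term (inject₁ i)
        ≈⟨ *-congˡ (*-congʳ (trans (entry i zero) (*-congʳ (trans (-‿cong g₀-vanishes) ε⁻¹≈ε)))) ⟩
      sgn (inject₁ i) * ((0# * _) * _)  ≈⟨ *-congˡ (trans (*-congʳ (zeroˡ _)) (zeroˡ _)) ⟩
      sgn (inject₁ i) * 0#              ≈⟨ zeroʳ _ ⟩
      0# ∎
    lastRows : ∀ a b → V′ (punchIn (fromℕ n) a) (suc b) ≈ - W a b
    lastRows a b = trans (reflexive (≡.cong (λ r → V′ r (suc b)) (punchIn-fromℕ n a)))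
                         (trans (entry a (suc b)) (sym (-‿distribˡ-* _ _)))
    lastTerm : term (fromℕ n) ≈ (g zero * x zero ^ n) * det W
    lastTerm = begin
      sgn (fromℕ n) * (V′ (fromℕ n) zero * det (λ a b → V′ (punchIn (fromℕ n) a) (suc b)))
        ≈⟨ *-cong (reflexive (≡.cong sign (Fin.toℕ-fromℕ n)))
                  (*-cong (reflexive (≡.trans (subtractNext-last x₀⁻¹ V zero)
                                              (≡.cong (λ k → g zero * x zero ^ k) (Fin.toℕ-fromℕ n))))
                          (trans (det-cong lastRows) (det-neg W))) ⟩
      sign n * ((g zero * x zero ^ n) * (sign n * det W))
        ≈⟨ solve 3 (λ s a d → s :* (a :* (s :* d)) := (s :* s) :* (a :* d))
                 refl (sign n) (g zero * x zero ^ n) (det W) ⟩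
      (sign n * sign n) * ((g zero * x zero ^ n) * det W)
        ≈⟨ trans (*-congʳ (sign-square n)) (*-identityˡ _) ⟩
      (g zero * x zero ^ n) * det W ∎

  det-vandermonde-pos : ∀ {m} (x g : Vector m) → (∀ s → Pos (x s)) → (∀ s → Pos (g s)) →
                        (∀ i j → i Fin.< j → x i <ᶠ x j) → Pos (det (vandermonde x g))
  det-vandermonde-pos {zero}  x g x>0 g>0 x↑ = Pos-1#
  det-vandermonde-pos {suc n} x g x>0 g>0 x↑ =
    Pos-resp (sym (det-vandermonde-step x g x₀⁻¹ x₀x₀⁻¹≈1))
      (Pos-* (Pos-* (g>0 zero) (Pos-^ n (x>0 zero)))
             (det-vandermonde-pos (tail x) g′ (x>0 ∘ suc) g′>0 (λ i j i<j → x↑ (suc i) (suc j) (ℕ.s≤s i<j))))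
    where
    x₀⁻¹ : Carrier
    x₀⁻¹ = proj₁ (inverse (x zero) (Pos⇒≉0 (x>0 zero)))
    x₀x₀⁻¹≈1 : x zero * x₀⁻¹ ≈ 1#
    x₀x₀⁻¹≈1 = proj₂ (inverse (x zero) (Pos⇒≉0 (x>0 zero)))
    g′ : Vector n
    g′ s = g (suc s) * (x₀⁻¹ * x (suc s) - 1#)
    g′>0 : ∀ s → Pos (g′ s)
    g′>0 s = Pos-* (g>0 (suc s))
                   (Pos-resp scaled-gap (Pos-* (Pos-inverse (x>0 zero) x₀x₀⁻¹≈1) (x↑ zero (suc s) (ℕ.s≤s ℕ.z≤n))))
      where
      scaled-gap : x₀⁻¹ * (x (suc s) - x zero) ≈ x₀⁻¹ * x (suc s) - 1#
      scaled-gap = trans (solve 3 (λ c y z → c :* (y :- z) := c :* y :- z :* c) refl x₀⁻¹ (x (suc s)) (x zero))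
                         (+-congˡ (-‿cong x₀x₀⁻¹≈1))

updateAt-columns : ∀ {a} {A : Set a} {m l l′} (N : Fin m → Fin l → A) r (q : Fin l → A) (f : Fin l′ → Fin l) i j →
                   updateAt N r (const q) i (f j) ≡ updateAt (λ i s → N i (f s)) r (const (q ∘ f)) i j
updateAt-columns N r q f i j = ≡.cong (λ row → row j) (map-updateAt {f = _∘ f} (λ _ → ≡.refl) N r i)

module RankOneUpdate {c ℓ} (F : OrderedField c ℓ) where
  open LinAlg F hiding (zero)
  open FiniteSums F
  open Determinants F
  open IntegerCoefficientSolver commutativeRing using (solve; _:=_; _:+_; _:*_)
  open import Relation.Binary.Reasoning.Setoid setoid

  det-updateAt : ∀ {m} (N : Matrix (suc m) (suc m)) r q →
                 det (updateAt N r (const q)) ≈ sgn r * det (q ∷ removeAt N r)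
  det-updateAt N r q = begin
    det N′                                       ≈⟨ sgn-cancel r _ ⟨
    sgn r * (sgn r * det N′)                     ≈⟨ *-congˡ (det-rotate r N′) ⟨
    sgn r * det (N′ r ∷ removeAt N′ r)           ≈⟨ *-congˡ (det-cong-≡ rows) ⟩
    sgn r * det (q ∷ removeAt N r) ∎
    where
    N′ : Matrix _ _
    N′ = updateAt N r (const q)
    rows : ∀ a b → (N′ r ∷ removeAt N′ r) a b ≡ (q ∷ removeAt N r) a b
    rows zero    b = ≡.cong (λ row → row b) (updateAt-updates r N)
    rows (suc a) b = ≡.cong (λ row → row b) (updateAt-minimal (punchIn r a) r N (Fin.punchInᵢ≢i r a))

  det-updateAt-suc : ∀ {m} (N : Matrix (suc m) (suc m)) r q →
    det (updateAt N (suc r) (const q))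
      ≈ Σᶠ (λ j → sgn j * (N zero j * det (updateAt (λ a b → N (suc a) (punchIn j b)) r (const (q ∘ punchIn j)))))
  det-updateAt-suc N r q =
    expansion-cong (N zero) (λ j → det-cong-≡ (updateAt-columns (tail N) r q (punchIn j)))

  RankOneUpdateFormula : ℕ → Set (c ⊔ ℓ)
  RankOneUpdateFormula m = ∀ (p q : Vector m) (N : Matrix m m) →
    det (λ r s → p r * q s + N r s) ≈ det N + Σᶠ (λ r → p r * det (updateAt N r (const q)))

  -- Expand along row 0; the minors are again rank one updates, of the minors of N.
  rankOneUpdate : ∀ m → RankOneUpdateFormula m
  rankOneUpdate zero    p q N = sym (+-identityʳ _)
  rankOneUpdate (suc m) p q N = begin
    Σᶠ (λ j → sgn j * ((p zero * q j + N zero j) * dR j))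
      ≈⟨ Σ-cong splitTerm ⟩
    Σᶠ (λ j → A j + (B j + C j))
      ≈⟨ trans (Σ-distrib-+ A (λ j → B j + C j)) (+-congˡ (Σ-distrib-+ B C)) ⟩
    det N + (Σᶠ B + Σᶠ C)
      ≈⟨ +-congˡ (trans (+-cong ΣB ΣC) (+-comm _ _)) ⟩
    det N + Σᶠ (λ r → p r * det (updateAt N r (const q))) ∎
    where
    minorN : Fin (suc m) → Matrix m m
    minorN j a b = N (suc a) (punchIn j b)
    dR dN : Fin (suc m) → Carrier
    dR j = det (λ a b → p (suc a) * q (punchIn j b) + minorN j a b)
    dN j = det (minorN j)
    E : Fin (suc m) → Fin m → Carrier
    E j r = det (updateAt (minorN j) r (const (q ∘ punchIn j)))
    S : Fin (suc m) → Carrier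
    S j = Σᶠ (λ r → p (suc r) * E j r)
    dR≈dN+S : ∀ j → dR j ≈ dN j + S j
    dR≈dN+S j = rankOneUpdate m (tail p) (q ∘ punchIn j) (minorN j)
    A B C : Fin (suc m) → Carrier
    A j = sgn j * (N zero j * dN j)
    B j = sgn j * (N zero j * S j)
    C j = p zero * (sgn j * (q j * dR j))
    splitTerm : ∀ j → sgn j * ((p zero * q j + N zero j) * dR j) ≈ A j + (B j + C j)
    splitTerm j = begin
      sgn j * ((p zero * q j + N zero j) * dR j)
        ≈⟨ solve 5 (λ s p q n d → s :* ((p :* q :+ n) :* d) := s :* (n :* d) :+ p :* (s :* (q :* d)))
                 refl (sgn j) (p zero) (q j) (N zero j) (dR j) ⟩
      sgn j * (N zero j * dR j) + C j
        ≈⟨ +-congʳ (trans (*-congˡ (*-congˡ (dR≈dN+S j))) (distribˡ₂ (sgn j) (N zero j) (dN j) (S j))) ⟩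
      (A j + B j) + C j ≈⟨ +-assoc _ _ _ ⟩
      A j + (B j + C j) ∎
    reorder : (v : Vector (suc m)) →
              Σᶠ (λ j → sgn j * (v j * S j)) ≈ Σᶠ (λ r → p (suc r) * Σᶠ (λ j → sgn j * (v j * E j r)))
    reorder v = begin
      Σᶠ (λ j → sgn j * (v j * S j))
        ≈⟨ Σ-cong (λ j → sym (Σ-factorˡ₂ (sgn j) (v j) (λ r → p (suc r) * E j r))) ⟩
      Σᶠ (λ j → Σᶠ (λ r → sgn j * (v j * (p (suc r) * E j r))))
        ≈⟨ Σ-comm (λ j r → sgn j * (v j * (p (suc r) * E j r))) ⟩
      Σᶠ (λ r → Σᶠ (λ j → sgn j * (v j * (p (suc r) * E j r))))
        ≈⟨ Σ-cong (λ r → trans (Σ-cong (λ j → solve 4 (λ s n a e → s :* (n :* (a :* e)) := a :* (s :* (n :* e)))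
                                                       refl (sgn j) (v j) (p (suc r)) (E j r)))
                               (Σ-factorˡ (p (suc r)) (λ j → sgn j * (v j * E j r)))) ⟩
      Σᶠ (λ r → p (suc r) * Σᶠ (λ j → sgn j * (v j * E j r))) ∎
    ΣB : Σᶠ B ≈ Σᶠ (λ r → p (suc r) * det (updateAt N (suc r) (const q)))
    ΣB = trans (reorder (N zero)) (Σ-cong (λ r → *-congˡ (sym (det-updateAt-suc N r q))))
    -- with q in row 0, the matrices updateAt (q ∷ tail N) (r+1) q have two equal rows
    duplicated-zero : Σᶠ (λ j → sgn j * (q j * S j)) ≈ 0#
    duplicated-zero = trans (reorder q) (Σ-zero (λ r → trans (*-congˡ (begin
      Σᶠ (λ j → sgn j * (q j * E j r))              ≈⟨ det-updateAt-suc (q ∷ tail N) r q ⟨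
      det (updateAt (q ∷ tail N) (suc r) (const q))
        ≈⟨ det-equalRows₀ (updateAt (q ∷ tail N) (suc r) (const q)) r
             (λ j → reflexive (≡.cong (λ row → row j) (≡.sym (updateAt-updates r (tail N))))) ⟩
      0# ∎)) (zeroʳ _)))
    ΣC : Σᶠ C ≈ p zero * det (updateAt N zero (const q))
    ΣC = begin
      Σᶠ C                                                  ≈⟨ Σ-factorˡ (p zero) (λ j → sgn j * (q j * dR j)) ⟩
      p zero * Σᶠ (λ j → sgn j * (q j * dR j))              ≈⟨ *-congˡ (expansion-cong q dR≈dN+S) ⟩
      p zero * Σᶠ (λ j → sgn j * (q j * (dN j + S j)))
        ≈⟨ *-congˡ (Σ-cong (λ j → distribˡ₂ (sgn j) (q j) (dN j) (S j))) ⟩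
      p zero * Σᶠ (λ j → sgn j * (q j * dN j) + sgn j * (q j * S j))
        ≈⟨ *-congˡ (Σ-distrib-+ (λ j → sgn j * (q j * dN j)) (λ j → sgn j * (q j * S j))) ⟩
      p zero * (det (updateAt N zero (const q)) + Σᶠ (λ j → sgn j * (q j * S j)))
        ≈⟨ *-congˡ (trans (+-congˡ duplicated-zero) (+-identityʳ _)) ⟩
      p zero * det (updateAt N zero (const q)) ∎

  det-rankOneUpdate : ∀ {m} (p q : Vector (suc m)) (N : Matrix (suc m) (suc m)) →
    det (λ r s → p r * q s + N r s) ≈ det N + Σᶠ (λ r → p r * (sgn r * det (q ∷ removeAt N r)))
  det-rankOneUpdate {m} p q N =
    trans (rankOneUpdate (suc m) p q N) (+-congˡ (Σ-cong (λ r → *-congˡ {p r} (det-updateAt N r q))))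

module CauchyBinet {c ℓ} (F : OrderedField c ℓ) where
  open LinAlg F hiding (zero)
  open FiniteSums F
  open Positivity F
  open Determinants F
  open RankOneUpdate F
  open IntegerCoefficientSolver commutativeRing using (solve; _:=_; _:*_)
  open import Algebra.Properties.CommutativeSemigroup +-commutativeSemigroup using (interchange)
  open import Relation.Binary.Reasoning.Setoid setoid

  -- the sum over strictly increasing J : Fin k → Fin n, split by whether 0 is in the image of J
  ΣIncreasing : ∀ k n → ((Fin k → Fin n) → Carrier) → Carrier
  ΣIncreasing zero    n       g = g (λ ())
  ΣIncreasing (suc k) zero    g = 0#
  ΣIncreasing (suc k) (suc n) g = ΣIncreasing k n (g ∘ Fin.lift 1) + ΣIncreasing (suc k) n (λ J → g (suc ∘ J))

  ΣIncreasing-cong : ∀ k n {g h : (Fin k → Fin n) → Carrier} → (∀ J → g J ≈ h J) →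
                     ΣIncreasing k n g ≈ ΣIncreasing k n h
  ΣIncreasing-cong zero    n       g≈h = g≈h _
  ΣIncreasing-cong (suc k) zero    g≈h = refl
  ΣIncreasing-cong (suc k) (suc n) g≈h =
    +-cong (ΣIncreasing-cong k n (g≈h ∘ Fin.lift 1)) (ΣIncreasing-cong (suc k) n (λ J → g≈h (suc ∘ J)))

  ΣIncreasing-distrib-+ : ∀ k n (g h : (Fin k → Fin n) → Carrier) →
                          ΣIncreasing k n (λ J → g J + h J) ≈ ΣIncreasing k n g + ΣIncreasing k n h
  ΣIncreasing-distrib-+ zero    n       g h = refl
  ΣIncreasing-distrib-+ (suc k) zero    g h = sym (+-identityʳ _)
  ΣIncreasing-distrib-+ (suc k) (suc n) g h =
    trans (+-cong (ΣIncreasing-distrib-+ k n _ _) (ΣIncreasing-distrib-+ (suc k) n _ _)) (interchange _ _ _ _)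

  ΣIncreasing-factorˡ : ∀ k n a (g : (Fin k → Fin n) → Carrier) →
                        ΣIncreasing k n (λ J → a * g J) ≈ a * ΣIncreasing k n g
  ΣIncreasing-factorˡ zero    n       a g = refl
  ΣIncreasing-factorˡ (suc k) zero    a g = sym (zeroʳ _)
  ΣIncreasing-factorˡ (suc k) (suc n) a g =
    trans (+-cong (ΣIncreasing-factorˡ k n a _) (ΣIncreasing-factorˡ (suc k) n a _)) (sym (distribˡ _ _ _))

  ΣIncreasing-zero : ∀ k n {g : (Fin k → Fin n) → Carrier} → (∀ J → g J ≈ 0#) → ΣIncreasing k n g ≈ 0#
  ΣIncreasing-zero zero    n       g≈0 = g≈0 _
  ΣIncreasing-zero (suc k) zero    g≈0 = refl
  ΣIncreasing-zero (suc k) (suc n) g≈0 =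
    trans (+-cong (ΣIncreasing-zero k n (g≈0 ∘ Fin.lift 1)) (ΣIncreasing-zero (suc k) n (λ J → g≈0 (suc ∘ J))))
          (+-identityˡ _)

  ΣIncreasing-Σ : ∀ k n {l} (f : Fin l → (Fin k → Fin n) → Carrier) →
                  ΣIncreasing k n (λ J → Σᶠ (λ r → f r J)) ≈ Σᶠ (λ r → ΣIncreasing k n (f r))
  ΣIncreasing-Σ k n {zero}  f = ΣIncreasing-zero k n (λ _ → refl)
  ΣIncreasing-Σ k n {suc l} f =
    trans (ΣIncreasing-distrib-+ k n (f zero) (λ J → Σᶠ (λ r → f (suc r) J))) (+-congˡ (ΣIncreasing-Σ k n (f ∘ suc)))

  Increasing-lift : ∀ {k n} {J : Fin k → Fin n} → Increasing J → Increasing (Fin.lift 1 J)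
  Increasing-lift J↑ zero    (suc j) _              = ℕ.s≤s ℕ.z≤n
  Increasing-lift J↑ (suc i) (suc j) (ℕ.s≤s i<j) = ℕ.s≤s (J↑ i j i<j)

  Increasing-suc : ∀ {k n} {J : Fin k → Fin n} → Increasing J → Increasing (suc ∘ J)
  Increasing-suc J↑ i j i<j = ℕ.s≤s (J↑ i j i<j)

  ΣIncreasing-nonNeg : ∀ k n (g : (Fin k → Fin n) → Carrier) → (∀ J → Increasing J → NonNeg (g J)) →
                       NonNeg (ΣIncreasing k n g)
  ΣIncreasing-nonNeg zero    n       g g≥0 = g≥0 _ (λ ())
  ΣIncreasing-nonNeg (suc k) zero    g g≥0 = inj₂ refl
  ΣIncreasing-nonNeg (suc k) (suc n) g g≥0 =
    NonNeg-+ (ΣIncreasing-nonNeg k n _ (λ J J↑ → g≥0 _ (Increasing-lift J↑)))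
             (ΣIncreasing-nonNeg (suc k) n _ (λ J J↑ → g≥0 _ (Increasing-suc J↑)))

  ΣIncreasing-pos : ∀ k n (g : (Fin k → Fin n) → Carrier) → k ℕ.≤ n → (∀ J → Increasing J → Pos (g J)) →
                    Pos (ΣIncreasing k n g)
  ΣIncreasing-pos zero    n       g k≤n          g>0 = g>0 _ (λ ())
  ΣIncreasing-pos (suc k) (suc n) g (ℕ.s≤s k≤n) g>0 =
    Pos-+-NonNeg (ΣIncreasing-pos k n _ k≤n (λ J J↑ → g>0 _ (Increasing-lift J↑)))
                 (ΣIncreasing-nonNeg (suc k) n _ (λ J J↑ → inj₁ (g>0 _ (Increasing-suc J↑))))

  gram : ∀ {k n} → Matrix k n → Matrix k n → Matrix k k
  gram P Q r s = P r · Q s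

  -- Peel off the first column: gram P Q is a rank one update of the Gram matrix of the other columns.
  cauchyBinet : ∀ k n (P Q : Matrix k n) → det (gram P Q) ≈ ΣIncreasing k n (λ J → plücker P J * plücker Q J)
  cauchyBinet zero    n       P Q = sym (*-identityˡ _)
  cauchyBinet (suc k) zero    P Q = det-head-zero _ (tail (gram P Q)) (λ _ → refl)
  cauchyBinet (suc k) (suc n) P Q = begin
    det (λ r s → p r * q s + gram P′ Q′ r s)
      ≈⟨ det-rankOneUpdate p q (gram P′ Q′) ⟩
    det (gram P′ Q′) + Σᶠ (λ r → p r * (sgn r * det (q ∷ removeAt (gram P′ Q′) r)))
      ≈⟨ +-cong (cauchyBinet (suc k) n P′ Q′) (trans firstColumn-gram (sym firstColumn-plücker)) ⟩
    ΣIncreasing (suc k) n (λ J → plücker P′ J * plücker Q′ J)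
      + ΣIncreasing k n (λ J → plücker P (Fin.lift 1 J) * plücker Q (Fin.lift 1 J))
      ≈⟨ +-comm _ _ ⟩
    ΣIncreasing (suc k) (suc n) (λ J → plücker P J * plücker Q J) ∎
    where
    p q : Vector (suc k)
    p r = P r zero
    q r = Q r zero
    P′ Q′ : Matrix (suc k) n
    P′ r i = P r (suc i)
    Q′ r i = Q r (suc i)
    A B : Fin (suc k) → (Fin k → Fin n) → Carrier
    A r J = plücker (removeAt P′ r) J
    B r J = plücker (removeAt Q′ r) J
    K : Fin (suc k) → Fin (suc k) → Carrier
    K r r′ = (sgn r * p r) * (sgn r′ * q r′)
    I : Fin (suc k) → Fin (suc k) → Carrier
    I r r′ = ΣIncreasing k n (λ J → A r J * B r′ J)
    firstColumn-gram : Σᶠ (λ r → p r * (sgn r * det (q ∷ removeAt (gram P′ Q′) r)))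
                       ≈ Σᶠ (λ r → Σᶠ (λ r′ → K r r′ * I r r′))
    firstColumn-gram = Σ-cong (λ r → begin
      p r * (sgn r * Σᶠ (λ r′ → sgn r′ * (q r′ * det (gram (removeAt P′ r) (removeAt Q′ r′)))))
        ≈⟨ *-congˡ (*-congˡ (expansion-cong q (λ r′ → cauchyBinet k n (removeAt P′ r) (removeAt Q′ r′)))) ⟩
      p r * (sgn r * Σᶠ (λ r′ → sgn r′ * (q r′ * I r r′)))
        ≈⟨ Σ-factorˡ₂ (p r) (sgn r) (λ r′ → sgn r′ * (q r′ * I r r′)) ⟨
      Σᶠ (λ r′ → p r * (sgn r * (sgn r′ * (q r′ * I r r′))))
        ≈⟨ Σ-cong (λ r′ → solve 5 (λ p s s′ q i → p :* (s :* (s′ :* (q :* i))) := ((s :* p) :* (s′ :* q)) :* i)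
                                  refl (p r) (sgn r) (sgn r′) (q r′) (I r r′)) ⟩
      Σᶠ (λ r′ → K r r′ * I r r′) ∎)
    expandP : ∀ J → plücker P (Fin.lift 1 J) ≈ Σᶠ (λ r → sgn r * (p r * A r J))
    expandP J = det-expandColumn₀ (λ r s → P r (Fin.lift 1 J s))
    expandQ : ∀ J → plücker Q (Fin.lift 1 J) ≈ Σᶠ (λ r → sgn r * (q r * B r J))
    expandQ J = det-expandColumn₀ (λ r s → Q r (Fin.lift 1 J s))
    term : Fin (suc k) → Fin (suc k) → (Fin k → Fin n) → Carrier
    term r r′ J = (sgn r * (p r * A r J)) * (sgn r′ * (q r′ * B r′ J))
    firstColumn-plücker : ΣIncreasing k n (λ J → plücker P (Fin.lift 1 J) * plücker Q (Fin.lift 1 J))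
                          ≈ Σᶠ (λ r → Σᶠ (λ r′ → K r r′ * I r r′))
    firstColumn-plücker = begin
      ΣIncreasing k n (λ J → plücker P (Fin.lift 1 J) * plücker Q (Fin.lift 1 J))
        ≈⟨ ΣIncreasing-cong k n (λ J → trans (*-cong (expandP J) (expandQ J))
                                            (Σ-*-Σ (λ r → sgn r * (p r * A r J)) (λ r′ → sgn r′ * (q r′ * B r′ J)))) ⟩
      ΣIncreasing k n (λ J → Σᶠ (λ r → Σᶠ (λ r′ → term r r′ J)))
        ≈⟨ ΣIncreasing-Σ k n (λ r J → Σᶠ (λ r′ → term r r′ J)) ⟩
      Σᶠ (λ r → ΣIncreasing k n (λ J → Σᶠ (λ r′ → term r r′ J)))
        ≈⟨ Σ-cong (λ r → ΣIncreasing-Σ k n (term r)) ⟩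
      Σᶠ (λ r → Σᶠ (λ r′ → ΣIncreasing k n (term r r′)))
        ≈⟨ Σ-cong (λ r → Σ-cong (λ r′ → trans
             (ΣIncreasing-cong k n (λ J → solve 6 (λ s p a s′ q b → (s :* (p :* a)) :* (s′ :* (q :* b))
                                                                 := ((s :* p) :* (s′ :* q)) :* (a :* b))
                                                  refl (sgn r) (p r) (A r J) (sgn r′) (q r′) (B r′ J)))
             (ΣIncreasing-factorˡ k n (K r r′) (λ J → A r J * B r′ J)))) ⟩
      Σᶠ (λ r → Σᶠ (λ r′ → K r r′ * I r r′)) ∎

module RowSpaces {c ℓ} (F : OrderedField c ℓ) where
  open LinAlg F hiding (zero)
  open FiniteSums F
  open Positivity F
  open Determinants F
  open CauchyBinet F
  open IntegerCoefficientSolver commutativeRing using (solve; _:=_; _:+_; _:*_; :-_; _:-_)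
  open import Algebra.Properties.Ring ring using (-‿distribˡ-*)
  open import Relation.Binary.Reasoning.Setoid setoid

  rows-∈span : ∀ {k n} (B : Matrix k n) i → B i ∈span B
  rows-∈span B i = δ i , λ j → sym (Σ-δ i (λ l → B l j))

  totallyPositive : ∀ {k n} (B : Matrix k n) → (∀ I → Increasing I → Pos (plücker B I)) →
                    TotallyPositive B
  totallyPositive B B>0 = B , (rows-∈span B , rows-∈span B) , B>0

  perp-rows : ∀ {k n} (A : Matrix k n) u → (∀ j → A j · u ≈ 0#) → u ∈perp A
  perp-rows A u Aⱼ·u≈0 x (a , x≈aA) = begin
    Σᶠ (λ i → x i * u i)
      ≈⟨ Σ-cong (λ i → begin
           x i * u i                            ≈⟨ *-congʳ (x≈aA i) ⟩
           Σᶠ (λ j → a j * A j i) * u i         ≈⟨ *-comm _ _ ⟩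
           u i * Σᶠ (λ j → a j * A j i)         ≈⟨ Σ-factorˡ (u i) (λ j → a j * A j i) ⟨
           Σᶠ (λ j → u i * (a j * A j i))
             ≈⟨ Σ-cong (λ j → solve 3 (λ x y z → x :* (y :* z) := y :* (z :* x)) refl (u i) (a j) (A j i)) ⟩
           Σᶠ (λ j → a j * (A j i * u i)) ∎) ⟩
    Σᶠ (λ i → Σᶠ (λ j → a j * (A j i * u i)))  ≈⟨ Σ-comm (λ i j → a j * (A j i * u i)) ⟩
    Σᶠ (λ j → Σᶠ (λ i → a j * (A j i * u i)))
      ≈⟨ Σ-zero (λ j → trans (Σ-factorˡ (a j) (λ i → A j i * u i)) (trans (*-congˡ (Aⱼ·u≈0 j)) (zeroʳ _))) ⟩
    0# ∎

  -- u · u = w · u - (w - u) · u vanishes if both w and w - u lie in span A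
  ∉span : ∀ {k m} (A : Matrix k (suc m)) w u → u ∈perp A → (λ i → w i - u i) ∈span A →
          Pos (u zero) → ¬ (w ∈span A)
  ∉span A w u u⊥A w-u∈A u₀>0 w∈A = Pos-irrefl (Pos-resp u·u≈0 u·u>0)
    where
    u·u>0 : Pos (u · u)
    u·u>0 = Pos-+-NonNeg (Pos-* u₀>0 u₀>0) (NonNeg-Σ-squares (u ∘ suc))
    u·u≈0 : u · u ≈ 0#
    u·u≈0 = begin
      Σᶠ (λ i → u i * u i)
        ≈⟨ Σ-cong (λ i → solve 2 (λ x y → y :* y := x :* y :+ (:- ((x :- y) :* y))) refl (w i) (u i)) ⟩
      Σᶠ (λ i → w i * u i + - ((w i - u i) * u i))
        ≈⟨ trans (Σ-distrib-+ (λ i → w i * u i) (λ i → - ((w i - u i) * u i)))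
                 (+-congˡ (Σ-distrib-neg (λ i → (w i - u i) * u i))) ⟩
      w · u - ((λ i → w i - u i) · u)      ≈⟨ +-cong (u⊥A w w∈A) (-‿cong (u⊥A _ w-u∈A)) ⟩
      0# - 0#                               ≈⟨ -‿inverseʳ 0# ⟩
      0# ∎

  -- u is D⁻¹ times the formal determinant with first row E₀, …, E_k and remaining rows
  -- A · E₀, …, A · E_k, expanded along its first row.
  module OrthogonalPart {k n} (A : Matrix k n) (w : Vector n)
                        (D⁻¹ : Carrier) (DD⁻¹≈1 : det (gram A A) * D⁻¹ ≈ 1#) where
    E : Matrix (suc k) n
    E = extend A w

    C : Fin (suc k) → Carrier
    C s = det (λ a b → A a · E (punchIn s b))

    u : Vector n
    u i = D⁻¹ * Σᶠ (λ s → sgn s * (E s i * C s))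

    ·-u : ∀ x → x · u ≈ D⁻¹ * det (gram (extend A x) E)
    ·-u x = begin
      Σᶠ (λ i → x i * (D⁻¹ * Σᶠ (λ s → sgn s * (E s i * C s))))
        ≈⟨ Σ-cong (λ i → trans (solve 3 (λ a b y → a :* (b :* y) := b :* (a :* y)) refl (x i) D⁻¹ (Σᶠ (term i)))
                               (*-congˡ (sym (Σ-factorˡ (x i) (term i))))) ⟩
      Σᶠ (λ i → D⁻¹ * Σᶠ (λ s → x i * (sgn s * (E s i * C s))))
        ≈⟨ Σ-factorˡ D⁻¹ (λ i → Σᶠ (λ s → x i * (sgn s * (E s i * C s)))) ⟩
      D⁻¹ * Σᶠ (λ i → Σᶠ (λ s → x i * (sgn s * (E s i * C s))))
        ≈⟨ *-congˡ (Σ-comm (λ i s → x i * (sgn s * (E s i * C s)))) ⟩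
      D⁻¹ * Σᶠ (λ s → Σᶠ (λ i → x i * (sgn s * (E s i * C s))))
        ≈⟨ *-congˡ (Σ-cong (λ s → begin
             Σᶠ (λ i → x i * (sgn s * (E s i * C s)))
               ≈⟨ Σ-cong (λ i → solve 4 (λ a y e z → a :* (y :* (e :* z)) := (y :* z) :* (a :* e))
                                       refl (x i) (sgn s) (E s i) (C s)) ⟩
             Σᶠ (λ i → (sgn s * C s) * (x i * E s i))  ≈⟨ Σ-factorˡ (sgn s * C s) (λ i → x i * E s i) ⟩
             (sgn s * C s) * (x · E s)
               ≈⟨ solve 3 (λ y z a → (y :* z) :* a := y :* (a :* z)) refl (sgn s) (C s) (x · E s) ⟩
             sgn s * ((x · E s) * C s) ∎)) ⟩
      D⁻¹ * det (gram (extend A x) E) ∎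
      where
      term : Fin n → Fin (suc k) → Carrier
      term i s = sgn s * (E s i * C s)

    u-perp : u ∈perp A
    u-perp = perp-rows A u (λ j → trans (·-u (A j))
      (trans (*-congˡ (det-equalRows₀ (gram (extend A (A j)) E) j (λ _ → refl))) (zeroʳ _)))

    u-coordinate : ∀ i → u i ≈ D⁻¹ * det (gram (extend A (δ i)) E)
    u-coordinate i = trans (sym (Σ-δ i u)) (·-u (δ i))

    -- the coefficient of E₀ = w in u is D⁻¹ C₀ = D⁻¹ D = 1
    w-u∈span : (λ i → w i - u i) ∈span A
    w-u∈span = coefficient , λ i → begin
      w i - D⁻¹ * (sgn {suc k} zero * (w i * D) + Σᶠ (λ s → sgn (suc s) * (A s i * C (suc s))))
        ≈⟨ +-congˡ (-‿cong (*-congˡ (+-cong (*-identityˡ _)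
                                             (Σ-cong (λ s → sym (-‿distribˡ-* (sgn s) (A s i * C (suc s)))))))) ⟩
      w i - D⁻¹ * (w i * D + Σᶠ (λ s → - rest s i))
        ≈⟨ +-congˡ (-‿cong (*-congˡ (+-congˡ (Σ-distrib-neg (λ s → rest s i))))) ⟩
      w i - D⁻¹ * (w i * D + - Σᶠ (λ s → rest s i))
        ≈⟨ solve 4 (λ o d x y → o :- d :* (o :* x :+ (:- y)) := (o :- o :* (x :* d)) :+ d :* y)
                 refl (w i) D⁻¹ D (Σᶠ (λ s → rest s i)) ⟩
      (w i - w i * (D * D⁻¹)) + D⁻¹ * Σᶠ (λ s → rest s i)
        ≈⟨ +-congʳ (trans (+-congˡ (-‿cong (trans (*-congˡ DD⁻¹≈1) (*-identityʳ _)))) (-‿inverseʳ _)) ⟩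
      0# + D⁻¹ * Σᶠ (λ s → rest s i)
        ≈⟨ trans (+-identityˡ _) (sym (Σ-factorˡ D⁻¹ (λ s → rest s i))) ⟩
      Σᶠ (λ s → D⁻¹ * rest s i)
        ≈⟨ Σ-cong (λ s → solve 4 (λ d y a z → d :* (y :* (a :* z)) := (d :* (y :* z)) :* a)
                                refl D⁻¹ (sgn s) (A s i) (C (suc s))) ⟩
      Σᶠ (λ s → coefficient s * A s i) ∎
      where
      D : Carrier
      D = det (gram A A)
      rest : Fin k → Fin n → Carrier
      rest s i = sgn s * (A s i * C (suc s))
      coefficient : Vector k
      coefficient s = D⁻¹ * (sgn s * C (suc s))

  gram-pos : ∀ {k n} (A : Matrix k n) → k ℕ.≤ n → (∀ I → Increasing I → Pos (plücker A I)) →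
             Pos (det (gram A A))
  gram-pos A k≤n A>0 = Pos-resp (sym (cauchyBinet _ _ A A))
    (ΣIncreasing-pos _ _ _ k≤n (λ J J↑ → Pos-* (A>0 J J↑) (A>0 J J↑)))

  module _ {k m} (A : Matrix k (suc m)) where
    plücker-extend-δ₀-suc : ∀ J → plücker (extend A (δ zero)) (suc ∘ J) ≈ 0#
    plücker-extend-δ₀-suc J = det-head-zero (λ s → δ zero (suc (J s))) (λ r s → A r (suc (J s))) (λ _ → refl)

    plücker-extend-δ₀-lift : ∀ J → plücker (extend A (δ zero)) (Fin.lift 1 J) ≈ plücker A (suc ∘ J)
    plücker-extend-δ₀-lift J = det-head-δ₀ (λ r s → A r (Fin.lift 1 J s))

    -- by Cauchy–Binet only the minors of extend A (δ zero) through column 0 survive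
    gram-extend-δ₀-pos : (E : Matrix (suc k) (suc m)) → k ℕ.≤ m →
      (∀ I → Increasing I → Pos (plücker A I)) → (∀ I → Increasing I → Pos (plücker E I)) →
      Pos (det (gram (extend A (δ zero)) E))
    gram-extend-δ₀-pos E k≤m A>0 E>0 =
      Pos-resp (sym (cauchyBinet (suc k) (suc m) (extend A (δ zero)) E))
        (Pos-+-NonNeg (ΣIncreasing-pos k m _ k≤m throughColumn₀)
                      (inj₂ (ΣIncreasing-zero (suc k) m (λ J → trans (*-congʳ (plücker-extend-δ₀-suc J)) (zeroˡ _)))))
      where
      throughColumn₀ : ∀ J → Increasing J →
                       Pos (plücker (extend A (δ zero)) (Fin.lift 1 J) * plücker E (Fin.lift 1 J))
      throughColumn₀ J J↑ = Pos-resp (*-congʳ (sym (plücker-extend-δ₀-lift J)))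
                                     (Pos-* (A>0 _ (Increasing-suc J↑)) (E>0 _ (Increasing-lift J↑)))

module MomentCurve {c ℓ} (F : OrderedField c ℓ) where
  open LinAlg F hiding (zero)
  open Positivity F
  open Determinants F
  open Vandermonde F
  open IntegerCoefficientSolver commutativeRing using (solve; _:=_; _:+_; _:-_)

  Pos-increasing : ∀ {m} (t : Vector (suc m)) → Pos (t zero) → (∀ i j → i Fin.< j → t i <ᶠ t j) →
                   ∀ i → Pos (t i)
  Pos-increasing t t₀>0 t↑ zero    = t₀>0
  Pos-increasing t t₀>0 t↑ (suc i) =
    Pos-resp (solve 2 (λ a b → a :+ (b :- a) := b) refl (t zero) (t (suc i)))
             (Pos-+ t₀>0 (t↑ zero (suc i) (ℕ.s≤s ℕ.z≤n)))

  module _ {n} (t : Vector n) (t>0 : ∀ i → Pos (t i)) (t↑ : ∀ i j → i Fin.< j → t i <ᶠ t j) where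
    -- the minors of the moment curve are Vandermonde determinants, with column weights t (I s) or 1
    plücker-moment-pos : ∀ {k} (I : Fin k → Fin n) → Increasing I → Pos (plücker (moment t) I)
    plücker-moment-pos I I↑ =
      det-vandermonde-pos (t ∘ I) (t ∘ I) (t>0 ∘ I) (t>0 ∘ I) (λ i j i<j → t↑ (I i) (I j) (I↑ i j i<j))

    plücker-extend-moment-pos : ∀ {k} (I : Fin (suc k) → Fin n) → Increasing I →
                                Pos (plücker (extend (moment t) (λ _ → 1#)) I)
    plücker-extend-moment-pos I I↑ = Pos-resp (det-cong entries)
      (det-vandermonde-pos (t ∘ I) (λ _ → 1#) (t>0 ∘ I) (λ _ → Pos-1#)
                           (λ i j i<j → t↑ (I i) (I j) (I↑ i j i<j)))
      where
      entries : ∀ r s → vandermonde (t ∘ I) (λ _ → 1#) r s ≈ extend (moment t) (λ _ → 1#) r (I s)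
      entries zero    s = *-identityˡ _
      entries (suc r) s = *-identityˡ _

proposition6p6 : ∀ {c ℓ} (F : OrderedField c ℓ) → let open LinAlg F in
    (k m : ℕ) → k < suc m → (t : Fin (suc m) → Carrier) →
    Pos (t Fin.zero) → (∀ i j → i Fin.< j → t i <ᶠ t j) →
    PositivelyOriented (moment {k} t) (λ _ → 1#)
proposition6p6 F k m k<n t t₀>0 t↑ =
  totallyPositive A A>0 , ∉span A w u u-perp w-u∈span u₀>0 , totallyPositive E E>0 , u , u-perp , w-u∈span , u₀>0
  where
  open LinAlg F hiding (zero)
  open Positivity F
  open CauchyBinet F using (gram)
  open RowSpaces F
  open MomentCurve F
  A : Matrix k (suc m)
  A = moment t
  w : Vector (suc m)
  w _ = 1#
  t>0 : ∀ i → Pos (t i)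
  t>0 = Pos-increasing t t₀>0 t↑
  A>0 : ∀ I → Increasing I → Pos (plücker A I)
  A>0 = plücker-moment-pos t t>0 t↑
  E>0 : ∀ I → Increasing I → Pos (plücker (extend A w) I)
  E>0 = plücker-extend-moment-pos t t>0 t↑
  D>0 : Pos (det (gram A A))
  D>0 = gram-pos A (ℕ.<⇒≤ k<n) A>0
  D⁻¹ : Carrier
  D⁻¹ = proj₁ (inverse (det (gram A A)) (Pos⇒≉0 D>0))
  DD⁻¹≈1 : det (gram A A) * D⁻¹ ≈ 1#
  DD⁻¹≈1 = proj₂ (inverse (det (gram A A)) (Pos⇒≉0 D>0))
  open OrthogonalPart A w D⁻¹ DD⁻¹≈1
  u₀>0 : Pos (u zero)
  u₀>0 = Pos-resp (sym (u-coordinate zero))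
    (Pos-* (Pos-inverse D>0 DD⁻¹≈1) (gram-extend-δ₀-pos A E (ℕ.s≤s⁻¹ k<n) A>0 E>0))
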